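{- Let $n\in\mathbb{N}$ and let $F:\mathcal{M}(n)\to\mathcal{D}(n)$ be the map defined in the context. 1. For every $M\in\mathcal{M}(n)$, $crs(M)=als(F(M))$. 2. For every $M,N\in\mathcal{M}(n)$, the sequences $crs(M)$ and $crs(N)$ are equal as multisets (ignoring order) if and only if $pr(F(M))=pr(F(N))$. 3. For every composition $a=(a_1,\dots,a_m)$ of $n$ and every integer $i$ with $0\le i\le\sum_{j=1}^m(j-1)a_j$ there is $M\in\mathcal{M}(n)$ with $pr(F(M))=a$ and $cr(M)=i$; and there are no composition $a$ and $M\in\mathcal{M}(n)$ with $pr(F(M))=a$ and $cr(M)>\sum_{j=1}^m(j-1)a_j$.
   Context: A matching on $[2n]$ is a partition of $[2n]$ into $n$ two-element blocks (edges); $\mathcal{M}(n)$ is the set of such matchings; $cr(M)$ is the number of pairs of edges $A,B$ with $\min A<\min B<\max A<\max B$. The gaps of $M$ are numbered $1,\dots,2n+1$: gap 1 before 1, gap $j$ between $j-1$ and $j$, gap $2n+1$ after $2n$. The crossing sequence $crs(M)$ has as its $j$-th term ($1\le j\le 2n+1$) the number of edges $\{p,q\}$, $p<q$, with $p<j\le q$ (edges covering gap $j$). A Dyck path of semilength $n$ is a lattice path $(d_0,\dots,d_{2n})$ from $(0,0)$ to $(2n,0)$ with steps $(1,1)$ (up) and $(1,-1)$ (down) never going below the $x$-axis; $\mathcal{D}(n)$ is their set. For $d_i=(d_i^x,d_i^y)$, $als(D)=(d_0^y,\dots,d_{2n}^y)$. If $m$ is the maximum of $als(D)$, the profile $pr(D)=(a_1,\dots,a_m)$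 where $a_i$ is half the number of steps of $D$ lying in the strip $i-1\le y\le i$; it is a composition of $n$. $F(M)$ is the Dyck path whose $k$-th step is up if $k$ is the smaller element of its edge in $M$ and down otherwise. -}

module Defs where

open import Data.Bool using (Bool; true; false)
open import Data.Nat using (ℕ; zero; suc; _+_; _*_; _∸_; _≤_; _<_; _⊔_; _≟_; _<?_; _≤?_; ⌊_/2⌋)
open import Data.Fin using (Fin; toℕ)
open import Data.List using (List; []; _∷_; map; length; filter; upTo; zipWith; foldr; allFin; cartesianProduct)
open import Data.Nat.ListAction using (sum)
open import Data.List.Relation.Unary.All using (All)
open import Data.Product using (_×_; _,_)
open import Relation.Nullary using (does; ¬_)
open import Relation.Nullary.Decidable using (_×-dec_)
open import Relation.Binary.PropositionalEquality using (_≡_)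

-- Elements of [2n] are represented 0-based by Fin (2 * n): k ↦ toℕ k + 1.
-- A perfect matching on [2n] is encoded by its partner map: a fixed-point-free
-- involution (each block {p,q} is {k, partner k}).
record Matching (n : ℕ) : Set where
  field
    partner : Fin (2 * n) → Fin (2 * n)
    involutive : ∀ k → partner (partner k) ≡ k
    fixpointFree : ∀ k → ¬ (partner k ≡ k)
open Matching public

-- Lattice-path step words: true = up step (1,1), false = down step (1,-1).
Word : Set
Word = List Bool

heightsFrom : ℕ → Word → List ℕ
heightsFrom h [] = h ∷ []
heightsFrom h (true ∷ w) = h ∷ heightsFrom (suc h) w
heightsFrom h (false ∷ w) = h ∷ heightsFrom (h ∸ 1) w

als : Word → List ℕ
als = heightsFrom 0

-- Strip index of each step: the step between heights h and h±1 lies in strip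
-- i-1 ≤ y ≤ i with i = the larger of its two endpoint heights.
stripsFrom : ℕ → Word → List ℕ
stripsFrom h [] = []
stripsFrom h (true ∷ w) = suc h ∷ stripsFrom (suc h) w
stripsFrom h (false ∷ w) = h ∷ stripsFrom (h ∸ 1) w

maxList : List ℕ → ℕ
maxList = foldr _⊔_ 0

pr : Word → List ℕ
pr w = map (λ i → ⌊ length (filter (λ s → s ≟ i) (stripsFrom 0 w)) /2⌋)
           (map suc (upTo (maxList (als w))))

F : {n : ℕ} → Matching n → Word
F M = map (λ k → does (toℕ k <? toℕ (partner M k))) (allFin _)

-- crs(M): for gap index g = j - 1 ∈ {0,...,2n}, the number of edges {p,q}
-- (0-based p < q) with p < g ≤ q, i.e. edges covering gap j.
crs : {n : ℕ} → Matching n → List ℕ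
crs {n} M = map covering (upTo (suc (2 * n)))
  where
  covering : ℕ → ℕ
  covering g = length (filter
    (λ k → (toℕ k <? toℕ (partner M k)) ×-dec ((toℕ k <? g) ×-dec (g ≤? toℕ (partner M k))))
    (allFin _))

-- cr(M): number of pairs of edges A, B with min A < min B < max A < max B.
-- Counted as pairs (x, y) with x < y < M x < M y (x = min A, y = min B).
cr : {n : ℕ} → Matching n → ℕ
cr M = length (filter
  (λ { (x , y) → (toℕ x <? toℕ y) ×-dec ((toℕ y <? toℕ (partner M x)) ×-dec (toℕ (partner M x) <? toℕ (partner M y))) })
  (cartesianProduct (allFin _) (allFin _)))

IsComposition : ℕ → List ℕ → Set
IsComposition n a = All (λ x → 0 < x) a × sum a ≡ n

weight : List ℕ → ℕ
weight a = sum (zipWith _*_ (upTo (length a)) a)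

{-# OPTIONS --safe #-}
module Submission where

-- Matchings are handled through their partner maps f on [0, N).
-- Crossing sequence: passing position j adds the arc that opens at j or removes the arc that closes
-- there, so the numbers of arcs covering the gaps form the height sequence of F(M).
-- Profile: in a Dyck path every up-step in strip i is matched by a down-step in strip i, so the profile
-- counts up-steps per strip; these counts and the multiset of heights determine each other.
-- Upper bound: if the arcs at x < y cross, then y is an opener covered by the arc at x, so cr(M) is at
-- most the sum of the heights at which up-steps start, which is the weight of the profile.
-- Realisation: the staircase path of a composition is built by adding its top strip last. Each new peak
-- follows the initial run of L up-steps, and its arc can be made to cross any k ≤ L of the L arcs open
-- there, so every crossing number up to the weight occurs.

open import Defs
open import Level using (Level)
open import Function using (_∘_; id; _⇔_; mk⇔)
open import Data.Bool using (Bool; true; false; if_then_else_)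
open import Data.Product using (Σ; ∃; ∃₂; _×_; _,_; proj₁; proj₂)
open import Data.Sum using (_⊎_; inj₁; inj₂)
open import Relation.Nullary using (¬_; Dec; yes; no; does; contradiction)
open import Relation.Nullary.Decidable using (dec-true; dec-false; does-⇔; _×-dec_)
open import Relation.Unary using (Pred; Decidable)
open import Relation.Binary.Definitions using (tri<; tri≈; tri>)
open import Relation.Binary.PropositionalEquality
open import Data.Nat using (ℕ; zero; suc; pred; _+_; _*_; _∸_; _≤_; _<_; _⊔_; z≤n; s≤s; s≤s⁻¹; ⌊_/2⌋)
open import Data.Nat.Properties
open import Data.Nat.ListAction using (sum)
open import Data.Nat.ListAction.Properties using (sum-++)
open import Data.Nat.Tactic.RingSolver using (solve-∀)
open import Algebra.Properties.CommutativeSemigroup +-commutativeSemigroup using (interchange)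
open import Data.Fin using (Fin; toℕ; fromℕ<) renaming (zero to fzero; suc to fsuc)
open import Data.Fin.Properties using (toℕ-injective; toℕ<n; fromℕ<-toℕ; toℕ-fromℕ<)
open import Data.List using (List; []; _∷_; _++_; _∷ʳ_; map; length; filter; applyUpTo; upTo; tabulate; allFin; cartesianProduct; replicate; zipWith)
open import Data.List.Properties
  using ( ++-assoc; ++-identityʳ; ∷-injective; upTo-∷ʳ; length-++; length-map; length-upTo; length-applyUpTo
        ; length-replicate; map-tabulate; map-applyUpTo; map-upTo; filter-++; filter-all; filter-none )
open import Data.List.Reverse using (Reverse; []; _∶_∶ʳ_; reverseView)
open import Data.List.Membership.Propositional using (_∈_)
open import Data.List.Membership.Propositional.Properties using (∈-∃++)
open import Data.List.Relation.Unary.Any using (here; there)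
open import Data.List.Relation.Unary.All using (All; []; _∷_)
import Data.List.Relation.Unary.All as All
open import Data.List.Relation.Unary.All.Properties using (replicate⁺; ++⁻ˡ; ++⁻ʳ)
open import Data.List.Relation.Binary.Permutation.Propositional using (_↭_; ↭-refl; ↭-sym; ↭-trans; prep; ↭⇒↭ₛ)
open import Data.List.Relation.Binary.Permutation.Propositional.Properties using (↭-length; filter-↭; shift)
open import Data.List.Relation.Binary.Permutation.Setoid.Properties using (foldr-commMonoid)

𝟙 : ∀ {p} {P : Set p} → Dec P → ℕ
𝟙 p? = if does p? then 1 else 0

module _ {p : Level} {P : Set p} where

  𝟙-yes : (p? : Dec P) → P → 𝟙 p? ≡ 1
  𝟙-yes p? p rewrite dec-true p? p = refl

  𝟙-no : (p? : Dec P) → ¬ P → 𝟙 p? ≡ 0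
  𝟙-no p? ¬p rewrite dec-false p? ¬p = refl

module _ {p q : Level} {P : Set p} {Q : Set q} where

  𝟙-mono : (p? : Dec P) (q? : Dec Q) → (P → Q) → 𝟙 p? ≤ 𝟙 q?
  𝟙-mono (yes p) q? P⇒Q = ≤-reflexive (sym (𝟙-yes q? (P⇒Q p)))
  𝟙-mono (no _) _ _ = z≤n

  𝟙-cong : (p? : Dec P) (q? : Dec Q) → (P → Q) → (Q → P) → 𝟙 p? ≡ 𝟙 q?
  𝟙-cong p? q? P⇒Q Q⇒P = cong (if_then 1 else 0) (does-⇔ (mk⇔ P⇒Q Q⇒P) p? q?)

from-does : ∀ {p} {P : Set p} (p? : Dec P) → does p? ≡ true → P
from-does (yes p) _ = p

∑< : ℕ → (ℕ → ℕ) → ℕ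
∑< zero g = 0
∑< (suc N) g = g 0 + ∑< N (g ∘ suc)

syntax ∑< N (λ j → e) = ∑[ j < N ] e

∑-cong : ∀ N {g h : ℕ → ℕ} → (∀ {j} → j < N → g j ≡ h j) → ∑< N g ≡ ∑< N h
∑-cong zero _ = refl
∑-cong (suc N) g≗h = cong₂ _+_ (g≗h (s≤s z≤n)) (∑-cong N (g≗h ∘ s≤s))

∑-+ : ∀ N (g h : ℕ → ℕ) → ∑[ j < N ] (g j + h j) ≡ ∑< N g + ∑< N h
∑-+ zero g h = refl
∑-+ (suc N) g h = trans (cong (g 0 + h 0 +_) (∑-+ N (g ∘ suc) (h ∘ suc))) (interchange (g 0) (h 0) _ _)

∑-mono-≤ : ∀ N {g h : ℕ → ℕ} → (∀ {j} → j < N → g j ≤ h j) → ∑< N g ≤ ∑< N h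
∑-mono-≤ zero _ = z≤n
∑-mono-≤ (suc N) g≤h = +-mono-≤ (g≤h (s≤s z≤n)) (∑-mono-≤ N (g≤h ∘ s≤s))

∑-zero : ∀ N {g : ℕ → ℕ} → (∀ {j} → j < N → g j ≡ 0) → ∑< N g ≡ 0
∑-zero N g≗0 = trans (∑-cong N g≗0) (∑-const0 N)
  where
  ∑-const0 : ∀ N → ∑[ j < N ] 0 ≡ 0
  ∑-const0 zero = refl
  ∑-const0 (suc N) = ∑-const0 N

∑-swap : ∀ N M (g : ℕ → ℕ → ℕ) → ∑[ x < N ] ∑[ y < M ] g x y ≡ ∑[ y < M ] ∑[ x < N ] g x y
∑-swap zero M g = sym (∑-zero M (λ _ → refl))
∑-swap (suc N) M g = trans (cong (∑< M (g 0) +_) (∑-swap N M (g ∘ suc))) (sym (∑-+ M (g 0) _))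

-- ℕ-analogues of Data.Fin's punchIn and punchOut; punchOut a a is junk.
punchIn : ℕ → ℕ → ℕ
punchIn zero j = suc j
punchIn (suc a) zero = zero
punchIn (suc a) (suc j) = suc (punchIn a j)

punchOut : ℕ → ℕ → ℕ
punchOut zero x = pred x
punchOut (suc a) zero = zero
punchOut (suc a) (suc x) = suc (punchOut a x)

punchIn-< : ∀ {a j} → j < a → punchIn a j ≡ j
punchIn-< {suc a} {zero} _ = refl
punchIn-< {suc a} {suc j} (s≤s j<a) = cong suc (punchIn-< j<a)

punchIn-≥ : ∀ {a j} → a ≤ j → punchIn a j ≡ suc j
punchIn-≥ {zero} _ = refl
punchIn-≥ {suc a} {suc j} (s≤s a≤j) = cong suc (punchIn-≥ a≤j)

punchIn-mono-< : ∀ a {x y} → x < y → punchIn a x < punchIn a y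
punchIn-mono-< zero x<y = s≤s x<y
punchIn-mono-< (suc a) {zero} {suc y} _ = s≤s z≤n
punchIn-mono-< (suc a) {suc x} {suc y} (s≤s x<y) = s≤s (punchIn-mono-< a x<y)

punchIn-cancel-< : ∀ a {x y} → punchIn a x < punchIn a y → x < y
punchIn-cancel-< a {x} {y} px<py with <-cmp x y
... | tri< x<y _ _ = x<y
... | tri≈ _ refl _ = contradiction px<py (n≮n _)
... | tri> _ _ y<x = contradiction (punchIn-mono-< a y<x) (<-asym px<py)

punchIn-injective : ∀ a {x y} → punchIn a x ≡ punchIn a y → x ≡ y
punchIn-injective a {x} {y} px≡py with <-cmp x y
... | tri< x<y _ _ = contradiction px≡py (<⇒≢ (punchIn-mono-< a x<y))
... | tri≈ _ x≡y _ = x≡y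
... | tri> _ _ y<x = contradiction (sym px≡py) (<⇒≢ (punchIn-mono-< a y<x))

punchInᵢ≢i : ∀ a j → punchIn a j ≢ a
punchInᵢ≢i (suc a) (suc j) e = punchInᵢ≢i a j (suc-injective e)

punchIn-bounded : ∀ a {j N} → j < N → punchIn a j < suc N
punchIn-bounded zero j<N = s≤s j<N
punchIn-bounded (suc a) {zero} _ = s≤s z≤n
punchIn-bounded (suc a) {suc j} {suc N} (s≤s j<N) = s≤s (punchIn-bounded a j<N)

punchIn-inflationary : ∀ a j → j ≤ punchIn a j
punchIn-inflationary zero j = n≤1+n j
punchIn-inflationary (suc a) zero = z≤n
punchIn-inflationary (suc a) (suc j) = s≤s (punchIn-inflationary a j)

punchOut-punchIn : ∀ a j → punchOut a (punchIn a j) ≡ j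
punchOut-punchIn zero j = refl
punchOut-punchIn (suc a) zero = refl
punchOut-punchIn (suc a) (suc j) = cong suc (punchOut-punchIn a j)

punchIn-punchOut : ∀ {a x} → x ≢ a → punchIn a (punchOut a x) ≡ x
punchIn-punchOut {zero} {zero} x≢a = contradiction refl x≢a
punchIn-punchOut {zero} {suc x} _ = refl
punchIn-punchOut {suc a} {zero} _ = refl
punchIn-punchOut {suc a} {suc x} x≢a = cong suc (punchIn-punchOut (x≢a ∘ cong suc))

punchOut-bounded : ∀ {a x N} → a ≤ N → x < suc N → x ≢ a → punchOut a x < N
punchOut-bounded {zero} {zero} _ _ x≢a = contradiction refl x≢a
punchOut-bounded {zero} {suc x} _ (s≤s x<N) _ = x<N
punchOut-bounded {suc a} {zero} {suc N} _ _ _ = s≤s z≤n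
punchOut-bounded {suc a} {suc x} {suc N} (s≤s a≤N) (s≤s x<N) x≢a =
  s≤s (punchOut-bounded a≤N x<N (x≢a ∘ cong suc))

punchIn-surjective : ∀ {a N x} → a ≤ N → x < suc N → x ≢ a → ∃ λ j → j < N × punchIn a j ≡ x
punchIn-surjective a≤N x<1+N x≢a = _ , punchOut-bounded a≤N x<1+N x≢a , punchIn-punchOut x≢a

∑-punchIn : ∀ N {a} (h : ℕ → ℕ) → a ≤ N → ∑< (suc N) h ≡ h a + ∑< N (h ∘ punchIn a)
∑-punchIn N {zero} h _ = refl
∑-punchIn (suc N) {suc a} h (s≤s a≤N) = begin
  h 0 + ∑< (suc N) (h ∘ suc)                        ≡⟨ cong (h 0 +_) (∑-punchIn N (h ∘ suc) a≤N) ⟩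
  h 0 + (h (suc a) + ∑< N (h ∘ suc ∘ punchIn a))    ≡⟨ +-comm (h 0) _ ⟩
  h (suc a) + ∑< N (h ∘ suc ∘ punchIn a) + h 0      ≡⟨ +-assoc (h (suc a)) _ _ ⟩
  h (suc a) + (∑< N (h ∘ suc ∘ punchIn a) + h 0)    ≡⟨ cong (h (suc a) +_) (+-comm _ (h 0)) ⟩
  h (suc a) + (h 0 + ∑< N (h ∘ suc ∘ punchIn a))    ∎
  where open ≡-Reasoning

∑-single : ∀ N {a} (h : ℕ → ℕ) → a < N → (∀ {j} → j < N → j ≢ a → h j ≡ 0) → ∑< N h ≡ h a
∑-single (suc N) {a} h a<N h≗0 = begin
  ∑< (suc N) h                  ≡⟨ ∑-punchIn N h (m<1+n⇒m≤n a<N) ⟩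
  h a + ∑< N (h ∘ punchIn a)    ≡⟨ cong (h a +_) (∑-zero N (λ j<N → h≗0 (punchIn-bounded a j<N) (punchInᵢ≢i a _))) ⟩
  h a + 0                       ≡⟨ +-identityʳ (h a) ⟩
  h a                           ∎
  where open ≡-Reasoning

∑-punchIn₂ : ∀ N {a b} (h : ℕ → ℕ) → a < b → b ≤ suc N →
  ∑< (suc (suc N)) h ≡ h b + (h a + ∑< N (h ∘ punchIn b ∘ punchIn a))
∑-punchIn₂ N {a} {b} h a<b b≤1+N = begin
  ∑< (suc (suc N)) h                                              ≡⟨ ∑-punchIn (suc N) h b≤1+N ⟩
  h b + ∑< (suc N) (h ∘ punchIn b)                                ≡⟨ cong (h b +_) (∑-punchIn N (h ∘ punchIn b) (m<1+n⇒m≤n (<-≤-trans a<b b≤1+N))) ⟩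
  h b + (h (punchIn b a) + ∑< N (h ∘ punchIn b ∘ punchIn a))      ≡⟨ cong (λ c → h b + (h c + ∑< N (h ∘ punchIn b ∘ punchIn a))) (punchIn-< a<b) ⟩
  h b + (h a + ∑< N (h ∘ punchIn b ∘ punchIn a))                  ∎
  where open ≡-Reasoning

∑-interval : ∀ N lo k → lo + k ≤ N → ∑[ j < N ] 𝟙 (lo ≤? j ×-dec j <? lo + k) ≡ k
∑-interval N zero zero _ = ∑-zero N (λ _ → refl)
∑-interval (suc N) zero (suc k) (s≤s k≤N) = cong suc (trans
  (∑-cong N (λ {j} _ → 𝟙-cong (0 ≤? suc j ×-dec suc j <? suc k) (0 ≤? j ×-dec j <? k)
                                (λ (_ , q) → z≤n , s≤s⁻¹ q) (λ (_ , q) → z≤n , s≤s q)))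
  (∑-interval N zero k k≤N))
∑-interval (suc N) (suc lo) k (s≤s lo+k≤N) = trans
  (∑-cong N (λ {j} _ → 𝟙-cong (suc lo ≤? suc j ×-dec suc j <? suc lo + k) (lo ≤? j ×-dec j <? lo + k)
                                (λ (p , q) → s≤s⁻¹ p , s≤s⁻¹ q) (λ (p , q) → s≤s p , s≤s q)))
  (∑-interval N lo k lo+k≤N)

≤-+-split : ∀ {t} m n → t ≤ m + n → ∃₂ λ p q → p ≤ m × q ≤ n × t ≡ p + q
≤-+-split {t} m n t≤m+n with t ≤? m
... | yes t≤m = t , 0 , t≤m , z≤n , sym (+-identityʳ t)
... | no t≰m = m , t ∸ m , ≤-refl , m≤n+o⇒m∸n≤o t m t≤m+n , sym (m+[n∸m]≡n (<⇒≤ (≰⇒> t≰m)))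

applyUpTo-cong : ∀ {a} {A : Set a} N {g h : ℕ → A} → (∀ {j} → j < N → g j ≡ h j) → applyUpTo g N ≡ applyUpTo h N
applyUpTo-cong zero _ = refl
applyUpTo-cong (suc N) g≗h = cong₂ _∷_ (g≗h (s≤s z≤n)) (applyUpTo-cong N (g≗h ∘ s≤s))

applyUpTo-injective : ∀ {a} {A : Set a} m {f g : ℕ → A} → applyUpTo f m ≡ applyUpTo g m → ∀ {i} → i < m → f i ≡ g i
applyUpTo-injective (suc m) e {zero} _ = proj₁ (∷-injective e)
applyUpTo-injective (suc m) e {suc i} (s≤s i<m) = applyUpTo-injective m (proj₂ (∷-injective e)) i<m

length-∷ʳ : ∀ {ℓ} {A : Set ℓ} (xs : List A) x → length (xs ∷ʳ x) ≡ suc (length xs)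
length-∷ʳ xs x = trans (length-++ xs) (+-comm (length xs) 1)

zipWith-∷ʳ : ∀ {A B C : Set} (f : A → B → C) {xs ys} x y → length xs ≡ length ys →
  zipWith f (xs ∷ʳ x) (ys ∷ʳ y) ≡ zipWith f xs ys ∷ʳ f x y
zipWith-∷ʳ f {[]} {[]} x y _ = refl
zipWith-∷ʳ f {x′ ∷ xs} {y′ ∷ ys} x y e = cong (f x′ y′ ∷_) (zipWith-∷ʳ f x y (suc-injective e))

insertAt : ∀ {a} {A : Set a} → List A → ℕ → A → List A
insertAt xs zero v = v ∷ xs
insertAt [] (suc i) v = v ∷ []
insertAt (x ∷ xs) (suc i) v = x ∷ insertAt xs i v

module _ {ℓ : Level} {A : Set ℓ} where

  applyUpTo-punchIn : ∀ N {a} (h : ℕ → A) → a ≤ N → applyUpTo h (suc N) ≡ insertAt (applyUpTo (h ∘ punchIn a) N) a (h a)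
  applyUpTo-punchIn N {zero} h _ = refl
  applyUpTo-punchIn (suc N) {suc a} h (s≤s a≤N) = cong (h 0 ∷_) (applyUpTo-punchIn N (h ∘ suc) a≤N)

  applyUpTo-punchIn₂ : ∀ N {a b} (h : ℕ → A) → a < b → b ≤ suc N →
    applyUpTo h (suc (suc N)) ≡ insertAt (insertAt (applyUpTo (h ∘ punchIn b ∘ punchIn a) N) a (h a)) b (h b)
  applyUpTo-punchIn₂ N {a} {b} h a<b b≤1+N = begin
    applyUpTo h (suc (suc N))                                                            ≡⟨ applyUpTo-punchIn (suc N) h b≤1+N ⟩
    insertAt (applyUpTo (h ∘ punchIn b) (suc N)) b (h b)                                 ≡⟨ cong (λ l → insertAt l b (h b)) (applyUpTo-punchIn N (h ∘ punchIn b) a≤N) ⟩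
    insertAt (insertAt (applyUpTo (h ∘ punchIn b ∘ punchIn a) N) a (h (punchIn b a))) b (h b)
      ≡⟨ cong (λ c → insertAt (insertAt (applyUpTo (h ∘ punchIn b ∘ punchIn a) N) a (h c)) b (h b)) (punchIn-< a<b) ⟩
    insertAt (insertAt (applyUpTo (h ∘ punchIn b ∘ punchIn a) N) a (h a)) b (h b)        ∎
    where
    open ≡-Reasoning
    a≤N = m<1+n⇒m≤n (<-≤-trans a<b b≤1+N)

  insertAt-replicate : ∀ {a L} (x : A) R → a ≤ L → insertAt (replicate L x ++ R) a x ≡ x ∷ replicate L x ++ R
  insertAt-replicate {zero} x R _ = refl
  insertAt-replicate {suc a} {suc L} x R (s≤s a≤L) = cong (x ∷_) (insertAt-replicate x R a≤L)

  insertAt-after-replicate : ∀ L (x v : A) R → insertAt (replicate L x ++ R) L v ≡ replicate L x ++ v ∷ R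
  insertAt-after-replicate zero x v R = refl
  insertAt-after-replicate (suc L) x v R = cong (x ∷_) (insertAt-after-replicate L x v R)

  ∷-replicate-++ : ∀ L (x : A) R → x ∷ replicate L x ++ R ≡ replicate L x ++ x ∷ R
  ∷-replicate-++ zero x R = refl
  ∷-replicate-++ (suc L) x R = cong (x ∷_) (∷-replicate-++ L x R)

  applyUpTo-replicate-prefix : ∀ N L {u : ℕ → A} {x R} → applyUpTo u N ≡ replicate L x ++ R →
    L ≤ N × (∀ {j} → j < L → u j ≡ x)
  applyUpTo-replicate-prefix N zero _ = z≤n , λ ()
  applyUpTo-replicate-prefix (suc N) (suc L) {u} e with ∷-injective e
  ... | u0≡x , rest with applyUpTo-replicate-prefix N L {u ∘ suc} rest
  ...   | L≤N , prefix = s≤s L≤N , λ { {zero} _ → u0≡x ; {suc j} (s≤s j<L) → prefix j<L }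

module _ {a p : Level} {A : Set a} {P : Pred A p} (P? : Decidable P) where

  length-filter-tabulate : ∀ {q} N (h : Fin N → A) {Q : ℕ → Set q} (Q? : ∀ j → Dec (Q j)) →
    (∀ k → does (P? (h k)) ≡ does (Q? (toℕ k))) →
    length (filter P? (tabulate h)) ≡ ∑[ j < N ] 𝟙 (Q? j)
  length-filter-tabulate zero h Q? P≗Q = refl
  length-filter-tabulate (suc N) h Q? P≗Q with P? (h fzero) | Q? 0 | P≗Q fzero
  ... | yes _ | yes _ | _ = cong suc (length-filter-tabulate N (h ∘ fsuc) (Q? ∘ suc) (P≗Q ∘ fsuc))
  ... | no _ | no _ | _ = length-filter-tabulate N (h ∘ fsuc) (Q? ∘ suc) (P≗Q ∘ fsuc)

module _ {a b p : Level} {A : Set a} {B : Set b} {P : Pred (A × B) p} (P? : Decidable P) where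

  length-filter-cartesianProduct : ∀ N (xs : Fin N → A) (ys : List B) (g : ℕ → ℕ) →
    (∀ k → length (filter P? (map (xs k ,_) ys)) ≡ g (toℕ k)) →
    length (filter P? (cartesianProduct (tabulate xs) ys)) ≡ ∑< N g
  length-filter-cartesianProduct zero xs ys g row = refl
  length-filter-cartesianProduct (suc N) xs ys g row = begin
    length (filter P? (map (xs fzero ,_) ys ++ rest))                ≡⟨ cong length (filter-++ P? (map (xs fzero ,_) ys) rest) ⟩
    length (filter P? (map (xs fzero ,_) ys) ++ filter P? rest)      ≡⟨ length-++ (filter P? (map (xs fzero ,_) ys)) ⟩
    length (filter P? (map (xs fzero ,_) ys)) + length (filter P? rest)
      ≡⟨ cong₂ _+_ (row fzero) (length-filter-cartesianProduct N (xs ∘ fsuc) ys (g ∘ suc) (row ∘ fsuc)) ⟩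
    g 0 + ∑< N (g ∘ suc)                                             ∎
    where
    open ≡-Reasoning
    rest = cartesianProduct (tabulate (xs ∘ fsuc)) ys

record IsMatching (N : ℕ) (f : ℕ → ℕ) : Set where
  field
    bounded : ∀ {j} → j < N → f j < N
    self-inverse : ∀ {j} → j < N → f (f j) ≡ j
    no-fixpoint : ∀ {j} → j < N → f j ≢ j

dyckWord : ℕ → (ℕ → ℕ) → Word
dyckWord N f = applyUpTo (λ j → does (j <? f j)) N

Covers : ℕ → ℕ → ℕ → Set
Covers x y g = x < y × x < g × g ≤ y

covers? : ∀ x y g → Dec (Covers x y g)
covers? x y g = x <? y ×-dec (x <? g ×-dec g ≤? y)

cover : ℕ → (ℕ → ℕ) → ℕ → ℕ
cover N f g = ∑[ x < N ] 𝟙 (covers? x (f x) g)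

Crosses : (ℕ → ℕ) → ℕ → ℕ → Set
Crosses f x y = x < y × y < f x × f x < f y

crosses? : ∀ f x y → Dec (Crosses f x y)
crosses? f x y = x <? y ×-dec (y <? f x ×-dec f x <? f y)

crossings : ℕ → (ℕ → ℕ) → ℕ
crossings N f = ∑[ x < N ] ∑[ y < N ] 𝟙 (crosses? f x y)

module _ {n : ℕ} (M : Matching n) where

  -- Extended by the identity outside [0, 2n).
  partnerℕ : ℕ → ℕ
  partnerℕ j with j <? 2 * n
  ... | yes j<2n = toℕ (partner M (fromℕ< j<2n))
  ... | no _ = j

  partnerℕ-toℕ : ∀ k → partnerℕ (toℕ k) ≡ toℕ (partner M k)
  partnerℕ-toℕ k with toℕ k <? 2 * n
  ... | yes k<2n = cong (toℕ ∘ partner M) (fromℕ<-toℕ k k<2n)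
  ... | no k≮2n = contradiction (toℕ<n k) k≮2n

  partnerℕ-fromℕ< : ∀ {j} (j<2n : j < 2 * n) → partnerℕ j ≡ toℕ (partner M (fromℕ< j<2n))
  partnerℕ-fromℕ< j<2n = trans (cong partnerℕ (sym (toℕ-fromℕ< j<2n))) (partnerℕ-toℕ (fromℕ< j<2n))

  partnerℕ-isMatching : IsMatching (2 * n) partnerℕ
  partnerℕ-isMatching = record
    { bounded = λ j<2n → subst (_< 2 * n) (sym (partnerℕ-fromℕ< j<2n)) (toℕ<n _)
    ; self-inverse = λ {j} j<2n → begin
        partnerℕ (partnerℕ j)                           ≡⟨ cong partnerℕ (partnerℕ-fromℕ< j<2n) ⟩
        partnerℕ (toℕ (partner M (fromℕ< j<2n)))        ≡⟨ partnerℕ-toℕ _ ⟩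
        toℕ (partner M (partner M (fromℕ< j<2n)))       ≡⟨ cong toℕ (involutive M _) ⟩
        toℕ (fromℕ< j<2n)                               ≡⟨ toℕ-fromℕ< j<2n ⟩
        j                                               ∎
    ; no-fixpoint = λ j<2n e → fixpointFree M (fromℕ< j<2n)
        (toℕ-injective (trans (sym (partnerℕ-fromℕ< j<2n)) (trans e (sym (toℕ-fromℕ< j<2n)))))
    }
    where open ≡-Reasoning

  F≡dyckWord : F M ≡ dyckWord (2 * n) partnerℕ
  F≡dyckWord = trans (map-tabulate id _) (tabulate≡applyUpTo (2 * n) _ _ (λ k → cong (does ∘ (toℕ k <?_)) (sym (partnerℕ-toℕ k))))
    where
    tabulate≡applyUpTo : ∀ {A : Set} N (h : Fin N → A) (h′ : ℕ → A) → (∀ k → h k ≡ h′ (toℕ k)) → tabulate h ≡ applyUpTo h′ N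
    tabulate≡applyUpTo zero h h′ h≗h′ = refl
    tabulate≡applyUpTo (suc N) h h′ h≗h′ = cong₂ _∷_ (h≗h′ fzero) (tabulate≡applyUpTo N (h ∘ fsuc) (h′ ∘ suc) (h≗h′ ∘ fsuc))

  crs≡cover : crs M ≡ applyUpTo (cover (2 * n) partnerℕ) (suc (2 * n))
  crs≡cover = trans (map-upTo covering (suc (2 * n))) (applyUpTo-cong (suc (2 * n)) (λ {g} _ →
    length-filter-tabulate (coversAt g) (2 * n) id (λ j → covers? j (partnerℕ j) g)
      (λ k → cong (λ y → does (covers? (toℕ k) y g)) (sym (partnerℕ-toℕ k)))))
    where
    coversAt : ∀ g k → Dec (Covers (toℕ k) (toℕ (partner M k)) g)
    coversAt g k = covers? (toℕ k) (toℕ (partner M k)) g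
    covering : ℕ → ℕ
    covering g = length (filter (coversAt g) (allFin _))

  cr≡crossings : cr M ≡ crossings (2 * n) partnerℕ
  cr≡crossings = length-filter-cartesianProduct crossesAt (2 * n) id (allFin (2 * n)) _ (λ k →
    trans (cong (length ∘ filter crossesAt) (map-tabulate id (k ,_)))
      (length-filter-tabulate crossesAt (2 * n) (k ,_) (crosses? partnerℕ (toℕ k)) (λ l →
        cong₂ (λ y z → does (toℕ k <? toℕ l ×-dec (toℕ l <? y ×-dec y <? z)))
          (sym (partnerℕ-toℕ k)) (sym (partnerℕ-toℕ l)))))
    where
    crossesAt : ∀ ((k , l) : Fin (2 * n) × Fin (2 * n)) →
      Dec (toℕ k < toℕ l × toℕ l < toℕ (partner M k) × toℕ (partner M k) < toℕ (partner M l))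
    crossesAt (k , l) = toℕ k <? toℕ l ×-dec (toℕ l <? toℕ (partner M k) ×-dec toℕ (partner M k) <? toℕ (partner M l))

dyckWord-cong : ∀ N {f g : ℕ → ℕ} → (∀ {j} → j < N → f j ≡ g j) → dyckWord N f ≡ dyckWord N g
dyckWord-cong N f≗g = applyUpTo-cong N (λ {j} j<N → cong (does ∘ (j <?_)) (f≗g j<N))

crossings-cong : ∀ N {f g : ℕ → ℕ} → (∀ {j} → j < N → f j ≡ g j) → crossings N f ≡ crossings N g
crossings-cong N f≗g = ∑-cong N (λ {x} x<N → ∑-cong N (λ {y} y<N →
  cong₂ (λ u v → 𝟙 (x <? y ×-dec (y <? u ×-dec u <? v))) (f≗g x<N) (f≗g y<N)))

module _ {n : ℕ} {f : ℕ → ℕ} (isM : IsMatching (2 * n) f) where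
  open IsMatching isM

  private
    f⁺ : Fin (2 * n) → Fin (2 * n)
    f⁺ k = fromℕ< (bounded (toℕ<n k))

    toℕ-f⁺ : ∀ k → toℕ (f⁺ k) ≡ f (toℕ k)
    toℕ-f⁺ k = toℕ-fromℕ< _

  toMatching : Matching n
  toMatching = record
    { partner = f⁺
    ; involutive = λ k → toℕ-injective (trans (toℕ-f⁺ (f⁺ k)) (trans (cong f (toℕ-f⁺ k)) (self-inverse (toℕ<n k))))
    ; fixpointFree = λ k e → no-fixpoint (toℕ<n k) (trans (sym (toℕ-f⁺ k)) (cong toℕ e))
    }

  partnerℕ-toMatching : ∀ {j} → j < 2 * n → partnerℕ toMatching j ≡ f j
  partnerℕ-toMatching j<2n = trans (partnerℕ-fromℕ< toMatching j<2n) (trans (toℕ-f⁺ _) (cong f (toℕ-fromℕ< j<2n)))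

  F-toMatching : F toMatching ≡ dyckWord (2 * n) f
  F-toMatching = trans (F≡dyckWord toMatching) (dyckWord-cong (2 * n) partnerℕ-toMatching)

  cr-toMatching : cr toMatching ≡ crossings (2 * n) f
  cr-toMatching = trans (cr≡crossings toMatching) (crossings-cong (2 * n) partnerℕ-toMatching)

-- The crossing sequence is the height sequence

data Path : ℕ → Word → ℕ → Set where
  [] : ∀ {h} → Path h [] h
  up : ∀ {h w e} → Path (suc h) w e → Path h (true ∷ w) e
  down : ∀ {h w e} → Path h w e → Path (suc h) (false ∷ w) e

Dyck : Word → Set
Dyck w = Path 0 w 0

upStrips : ℕ → Word → List ℕ
upStrips h [] = []
upStrips h (true ∷ w) = suc h ∷ upStrips (suc h) w
upStrips h (false ∷ w) = upStrips (h ∸ 1) w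

Step : Bool → ℕ → ℕ → Set
Step true a b = b ≡ suc a
Step false a b = a ≡ suc b

Traces : ℕ → (ℕ → Bool) → (ℕ → ℕ) → Set
Traces L u c = ∀ {j} → j < L → Step (u j) (c j) (c (suc j))

private
  tail-traces : ∀ {L u c} → Traces (suc L) u c → Traces L (u ∘ suc) (c ∘ suc)
  tail-traces tr = tr ∘ s≤s

heightsFrom-traces : ∀ L u c → Traces L u c → heightsFrom (c 0) (applyUpTo u L) ≡ applyUpTo c (suc L)
heightsFrom-traces zero u c tr = refl
heightsFrom-traces (suc L) u c tr with u 0 | tr (s≤s z≤n)
... | true | c1≡ = cong (c 0 ∷_) (trans (cong (λ h → heightsFrom h rest) (sym c1≡)) (heightsFrom-traces L (u ∘ suc) (c ∘ suc) (tail-traces tr)))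
  where rest = applyUpTo (u ∘ suc) L
... | false | c0≡ = cong (c 0 ∷_) (trans (cong (λ h → heightsFrom (h ∸ 1) rest) c0≡) (heightsFrom-traces L (u ∘ suc) (c ∘ suc) (tail-traces tr)))
  where rest = applyUpTo (u ∘ suc) L

path-traces : ∀ L u c → Traces L u c → Path (c 0) (applyUpTo u L) (c L)
path-traces zero u c tr = []
path-traces (suc L) u c tr with u 0 | tr (s≤s z≤n)
... | true | c1≡ = up (subst (λ h → Path h rest (c (suc L))) c1≡ (path-traces L (u ∘ suc) (c ∘ suc) (tail-traces tr)))
  where rest = applyUpTo (u ∘ suc) L
... | false | c0≡ = subst (λ h → Path h (false ∷ rest) (c (suc L))) (sym c0≡) (down (path-traces L (u ∘ suc) (c ∘ suc) (tail-traces tr)))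
  where rest = applyUpTo (u ∘ suc) L

upStrips-traces : ∀ L u c → Traces L u c →
  ∑[ j < L ] (if u j then c j else 0) ≡ sum (map pred (upStrips (c 0) (applyUpTo u L)))
upStrips-traces zero u c tr = refl
upStrips-traces (suc L) u c tr with u 0 | tr (s≤s z≤n)
... | true | c1≡ = cong (c 0 +_) (trans (upStrips-traces L (u ∘ suc) (c ∘ suc) (tail-traces tr)) (cong (λ h → sum (map pred (upStrips h rest))) c1≡))
  where rest = applyUpTo (u ∘ suc) L
... | false | c0≡ = trans (upStrips-traces L (u ∘ suc) (c ∘ suc) (tail-traces tr)) (cong (λ h → sum (map pred (upStrips (h ∸ 1) rest))) (sym c0≡))
  where rest = applyUpTo (u ∘ suc) L

-- As the gap passes j, an arc x < y starts covering it when j = x and stops when j = y.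
covers-suc : ∀ x y j → 𝟙 (covers? x y (suc j)) + 𝟙 (x <? y ×-dec y ≟ j) ≡ 𝟙 (covers? x y j) + 𝟙 (x <? y ×-dec x ≟ j)
covers-suc x y j with x <? y
... | no x≮y = trans
  (cong₂ _+_ (𝟙-no (covers? x y (suc j)) (x≮y ∘ proj₁)) (𝟙-no (x <? y ×-dec y ≟ j) (x≮y ∘ proj₁)))
  (sym (cong₂ _+_ (𝟙-no (covers? x y j) (x≮y ∘ proj₁)) (𝟙-no (x <? y ×-dec x ≟ j) (x≮y ∘ proj₁))))
... | yes x<y with x ≟ j | y ≟ j
...   | yes refl | _ = trans
  (cong₂ _+_ (𝟙-yes (covers? x y (suc x)) (x<y , n<1+n x , x<y)) (𝟙-no (x <? y ×-dec y ≟ x) (λ (_ , y≡x) → <⇒≢ x<y (sym y≡x))))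
  (sym (cong₂ _+_ (𝟙-no (covers? x y x) (λ (_ , x<x , _) → n≮n x x<x)) (𝟙-yes (x <? y ×-dec x ≟ x) (x<y , refl))))
...   | no _ | yes refl = trans
  (cong₂ _+_ (𝟙-no (covers? x y (suc y)) (λ (_ , _ , y<y) → n≮n y y<y)) (𝟙-yes (x <? y ×-dec y ≟ y) (x<y , refl)))
  (sym (cong₂ _+_ (𝟙-yes (covers? x y y) (x<y , x<y , ≤-refl)) (𝟙-no (x <? y ×-dec x ≟ y) (<⇒≢ x<y ∘ proj₂))))
...   | no x≢j | no y≢j = cong₂ _+_
  (𝟙-cong (covers? x y (suc j)) (covers? x y j)
    (λ (x<y , x<1+j , 1+j≤y) → x<y , ≤∧≢⇒< (m<1+n⇒m≤n x<1+j) x≢j , <⇒≤ 1+j≤y)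
    (λ (x<y , x<j , j≤y) → x<y , m<n⇒m<1+n x<j , ≤∧≢⇒< j≤y (y≢j ∘ sym)))
  (trans (𝟙-no (x <? y ×-dec y ≟ j) (y≢j ∘ proj₂)) (sym (𝟙-no (x <? y ×-dec x ≟ j) (x≢j ∘ proj₂))))

step-of-balance : ∀ {p q} {P : Set p} {Q : Set q} {a b} (p? : Dec P) (q? : Dec Q) →
  (P → ¬ Q) → (¬ P → Q) → b + 𝟙 q? ≡ a + 𝟙 p? → Step (does p?) a b
step-of-balance {a = a} {b} (yes p) q? P⇒¬Q _ balance = begin
  b             ≡⟨ sym (+-identityʳ b) ⟩
  b + 0         ≡⟨ cong (b +_) (sym (𝟙-no q? (P⇒¬Q p))) ⟩
  b + 𝟙 q?      ≡⟨ balance ⟩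
  a + 1         ≡⟨ +-comm a 1 ⟩
  suc a         ∎
  where open ≡-Reasoning
step-of-balance {a = a} {b} (no ¬p) q? _ ¬P⇒Q balance = begin
  a             ≡⟨ sym (+-identityʳ a) ⟩
  a + 0         ≡⟨ sym balance ⟩
  b + 𝟙 q?      ≡⟨ cong (b +_) (𝟙-yes q? (¬P⇒Q ¬p)) ⟩
  b + 1         ≡⟨ +-comm b 1 ⟩
  suc b         ∎
  where open ≡-Reasoning

module _ {N : ℕ} {f : ℕ → ℕ} (isM : IsMatching N f) where
  open IsMatching isM

  cover-suc : ∀ {j} → j < N → cover N f (suc j) + 𝟙 (f j <? j) ≡ cover N f j + 𝟙 (j <? f j)
  cover-suc {j} j<N = begin
    cover N f (suc j) + 𝟙 (f j <? j)                                      ≡⟨ cong (cover N f (suc j) +_) (sym closers) ⟩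
    cover N f (suc j) + ∑[ x < N ] 𝟙 (x <? f x ×-dec f x ≟ j)              ≡⟨ sym (∑-+ N _ _) ⟩
    ∑[ x < N ] (𝟙 (covers? x (f x) (suc j)) + 𝟙 (x <? f x ×-dec f x ≟ j))  ≡⟨ ∑-cong N (λ {x} _ → covers-suc x (f x) j) ⟩
    ∑[ x < N ] (𝟙 (covers? x (f x) j) + 𝟙 (x <? f x ×-dec x ≟ j))          ≡⟨ ∑-+ N _ _ ⟩
    cover N f j + ∑[ x < N ] 𝟙 (x <? f x ×-dec x ≟ j)                      ≡⟨ cong (cover N f j +_) openers ⟩
    cover N f j + 𝟙 (j <? f j)                                            ∎
    where
    open ≡-Reasoning
    openers : ∑[ x < N ] 𝟙 (x <? f x ×-dec x ≟ j) ≡ 𝟙 (j <? f j)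
    openers = trans
      (∑-single N (λ x → 𝟙 (x <? f x ×-dec x ≟ j)) j<N (λ {x} _ x≢j → 𝟙-no (x <? f x ×-dec x ≟ j) (x≢j ∘ proj₂)))
      (𝟙-cong (j <? f j ×-dec j ≟ j) (j <? f j) proj₁ (_, refl))
    closers : ∑[ x < N ] 𝟙 (x <? f x ×-dec f x ≟ j) ≡ 𝟙 (f j <? j)
    closers = trans
      (∑-single N (λ x → 𝟙 (x <? f x ×-dec f x ≟ j)) (bounded j<N) (λ {x} x<N x≢fj →
        𝟙-no (x <? f x ×-dec f x ≟ j) (λ (_ , fx≡j) → x≢fj (trans (sym (self-inverse x<N)) (cong f fx≡j)))))
      (𝟙-cong (f j <? f (f j) ×-dec f (f j) ≟ j) (f j <? j)
        (λ (fj<ffj , _) → subst (f j <_) (self-inverse j<N) fj<ffj)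
        (λ fj<j → subst (f j <_) (sym (self-inverse j<N)) fj<j , self-inverse j<N))

  cover-traces : Traces N (λ j → does (j <? f j)) (cover N f)
  cover-traces {j} j<N = step-of-balance (j <? f j) (f j <? j) <-asym
    (λ j≮fj → ≤∧≢⇒< (≮⇒≥ j≮fj) (no-fixpoint j<N)) (cover-suc j<N)

  cover-0 : cover N f 0 ≡ 0
  cover-0 = ∑-zero N (λ {x} _ → 𝟙-no (covers? x (f x) 0) (λ (_ , x<0 , _) → n≮0 x<0))

  cover-N : cover N f N ≡ 0
  cover-N = ∑-zero N (λ {x} x<N → 𝟙-no (covers? x (f x) N) (λ (_ , _ , N≤fx) → <⇒≱ (bounded x<N) N≤fx))

  als-dyckWord : als (dyckWord N f) ≡ applyUpTo (cover N f) (suc N)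
  als-dyckWord = trans (cong (λ h → heightsFrom h (dyckWord N f)) (sym cover-0)) (heightsFrom-traces N _ (cover N f) cover-traces)

  dyckWord-Dyck : Dyck (dyckWord N f)
  dyckWord-Dyck = subst₂ (λ h e → Path h (dyckWord N f) e) cover-0 cover-N (path-traces N _ (cover N f) cover-traces)

  cover-upStrips : ∑[ j < N ] (if does (j <? f j) then cover N f j else 0) ≡ sum (map pred (upStrips 0 (dyckWord N f)))
  cover-upStrips = trans (upStrips-traces N _ (cover N f) cover-traces) (cong (λ h → sum (map pred (upStrips h (dyckWord N f)))) cover-0)

crs≡als : ∀ {n} (M : Matching n) → crs M ≡ als (F M)
crs≡als M = trans (crs≡cover M) (sym (trans (cong als (F≡dyckWord M)) (als-dyckWord (partnerℕ-isMatching M))))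

-- Profiles and multisets of heights

count : ℕ → List ℕ → ℕ
count i xs = length (filter (_≟ i) xs)

count-∷ : ∀ i x xs → count i (x ∷ xs) ≡ 𝟙 (x ≟ i) + count i xs
count-∷ i x xs with x Data.Nat.≡ᵇ i
... | true = refl
... | false = refl

count-none : ∀ i {xs} → All (_≢ i) xs → count i xs ≡ 0
count-none i none = cong length (filter-none (_≟ i) none)

𝟙-<-suc : ∀ i h → 𝟙 (i <? suc h) ≡ 𝟙 (h ≟ i) + 𝟙 (i <? h)
𝟙-<-suc zero zero = refl
𝟙-<-suc zero (suc h) = refl
𝟙-<-suc (suc i) zero = refl
𝟙-<-suc (suc i) (suc h) = 𝟙-<-suc i h

sum-map-count : ∀ N (g : ℕ → ℕ) {xs} → All (_< N) xs → sum (map g xs) ≡ ∑[ v < N ] (g v * count v xs)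
sum-map-count N g [] = sym (∑-zero N (λ {v} _ → *-zeroʳ (g v)))
sum-map-count N g {x ∷ xs} (x<N ∷ xs<N) = begin
  g x + sum (map g xs)                                          ≡⟨ cong₂ _+_ (sym single) (sum-map-count N g xs<N) ⟩
  ∑[ v < N ] (g v * 𝟙 (x ≟ v)) + ∑[ v < N ] (g v * count v xs)  ≡⟨ sym (∑-+ N _ _) ⟩
  ∑[ v < N ] (g v * 𝟙 (x ≟ v) + g v * count v xs)               ≡⟨ ∑-cong N (λ {v} _ → sym (*-distribˡ-+ (g v) _ _)) ⟩
  ∑[ v < N ] (g v * (𝟙 (x ≟ v) + count v xs))                   ≡⟨ ∑-cong N (λ {v} _ → cong (g v *_) (sym (count-∷ v x xs))) ⟩
  ∑[ v < N ] (g v * count v (x ∷ xs))                           ∎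
  where
  open ≡-Reasoning
  single : ∑[ v < N ] (g v * 𝟙 (x ≟ v)) ≡ g x
  single = trans
    (∑-single N (λ v → g v * 𝟙 (x ≟ v)) x<N (λ {v} _ v≢x → trans (cong (g v *_) (𝟙-no (x ≟ v) (v≢x ∘ sym))) (*-zeroʳ (g v))))
    (trans (cong (g x *_) (𝟙-yes (x ≟ x) refl)) (*-identityʳ (g x)))

-- Besides the matched pairs, the descent from h to 0 leaves one down-step in each strip 1, …, h.
strips-count : ∀ {h w} → Path h w 0 → ∀ i → count (suc i) (stripsFrom h w) ≡ 2 * count (suc i) (upStrips h w) + 𝟙 (i <? h)
strips-count [] i = refl
strips-count (up {h} {w} p) i
  rewrite count-∷ (suc i) (suc h) (stripsFrom (suc h) w) | count-∷ (suc i) (suc h) (upStrips (suc h) w)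
        | strips-count p i | 𝟙-<-suc i h = rearrange (𝟙 (h ≟ i)) (count (suc i) (upStrips (suc h) w)) (𝟙 (i <? h))
  where
  rearrange : ∀ d c v → d + (2 * c + (d + v)) ≡ 2 * (d + c) + v
  rearrange = solve-∀
strips-count (down {h} {w} p) i
  rewrite count-∷ (suc i) (suc h) (stripsFrom h w) | strips-count p i | 𝟙-<-suc i h =
    rearrange (𝟙 (h ≟ i)) (count (suc i) (upStrips h w)) (𝟙 (i <? h))
  where
  rearrange : ∀ d c v → d + (2 * c + v) ≡ 2 * c + (d + v)
  rearrange = solve-∀

heights-count : ∀ {h₀ w} → Path h₀ w 0 → ∀ h →
  count h (heightsFrom h₀ w) ≡ count h (upStrips h₀ w) + count (suc h) (upStrips h₀ w) + 𝟙 (h <? suc h₀)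
heights-count [] zero = refl
heights-count [] (suc h) = refl
heights-count (up {h₀} {w} p) h
  rewrite count-∷ h h₀ (heightsFrom (suc h₀) w) | count-∷ h (suc h₀) (upStrips (suc h₀) w)
        | count-∷ (suc h) (suc h₀) (upStrips (suc h₀) w) | heights-count p h | 𝟙-<-suc h (suc h₀) =
    rearrange (𝟙 (h₀ ≟ h)) (count h (upStrips (suc h₀) w)) (count (suc h) (upStrips (suc h₀) w)) (𝟙 (suc h₀ ≟ h)) (𝟙 (h <? suc h₀))
  where
  rearrange : ∀ a c c′ e v → a + (c + c′ + (e + v)) ≡ e + c + (a + c′) + v
  rearrange = solve-∀
heights-count (down {h₀} {w} p) h
  rewrite count-∷ h (suc h₀) (heightsFrom h₀ w) | heights-count p h | 𝟙-<-suc h (suc h₀) =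
    rearrange (𝟙 (suc h₀ ≟ h)) (count h (upStrips h₀ w)) (count (suc h) (upStrips h₀ w)) (𝟙 (h <? suc h₀))
  where
  rearrange : ∀ e c c′ v → e + (c + c′ + v) ≡ c + c′ + (e + v)
  rearrange = solve-∀

height : Word → ℕ
height w = maxList (als w)

≤-maxList-heightsFrom : ∀ h w → h ≤ maxList (heightsFrom h w)
≤-maxList-heightsFrom h [] = m≤m⊔n h 0
≤-maxList-heightsFrom h (true ∷ w) = m≤m⊔n h _
≤-maxList-heightsFrom h (false ∷ w) = m≤m⊔n h _

upStrips-bounded : ∀ h w → All (_≤ maxList (heightsFrom h w)) (upStrips h w)
upStrips-bounded h [] = []
upStrips-bounded h (true ∷ w) =
  ≤-trans (≤-maxList-heightsFrom (suc h) w) (m≤n⊔m h _) ∷ All.map (λ s≤ → ≤-trans s≤ (m≤n⊔m h _)) (upStrips-bounded (suc h) w)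
upStrips-bounded h (false ∷ w) = All.map (λ s≤ → ≤-trans s≤ (m≤n⊔m h _)) (upStrips-bounded (h ∸ 1) w)

count-0-upStrips : ∀ h w → count 0 (upStrips h w) ≡ 0
count-0-upStrips h [] = refl
count-0-upStrips h (true ∷ w) = count-0-upStrips (suc h) w
count-0-upStrips h (false ∷ w) = count-0-upStrips (h ∸ 1) w

count-upStrips-beyond : ∀ h w {x} → maxList (heightsFrom h w) < x → count x (upStrips h w) ≡ 0
count-upStrips-beyond h w max<x = count-none _ (All.map (λ s≤max s≡x → <⇒≢ (≤-<-trans s≤max max<x) s≡x) (upStrips-bounded h w))

pr-upStrips : ∀ {w} → Dyck w → pr w ≡ applyUpTo (λ i → count (suc i) (upStrips 0 w)) (height w)
pr-upStrips {w} d = begin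
  map halfCount (map suc (upTo (height w)))    ≡⟨ cong (map halfCount) (map-upTo suc (height w)) ⟩
  map halfCount (applyUpTo suc (height w))     ≡⟨ map-applyUpTo suc halfCount (height w) ⟩
  applyUpTo (halfCount ∘ suc) (height w)       ≡⟨ applyUpTo-cong (height w) (λ {i} _ → halve (strips-count d i)) ⟩
  applyUpTo (λ i → count (suc i) (upStrips 0 w)) (height w) ∎
  where
  open ≡-Reasoning
  halfCount : ℕ → ℕ
  halfCount i = ⌊ count i (stripsFrom 0 w) /2⌋
  halve : ∀ {m c} → m ≡ 2 * c + 0 → ⌊ m /2⌋ ≡ c
  halve {c = c} refl = trans (cong ⌊_/2⌋ (trans (+-identityʳ (2 * c)) (cong (c +_) (+-identityʳ c)))) (sym (n≡⌊n+n/2⌋ c))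

weight-applyUpTo : ∀ m (g : ℕ → ℕ) → weight (applyUpTo g m) ≡ ∑[ i < m ] (i * g i)
weight-applyUpTo m g = begin
  sum (zipWith _*_ (upTo (length (applyUpTo g m))) (applyUpTo g m))   ≡⟨ cong (λ l → sum (zipWith _*_ (upTo l) (applyUpTo g m))) (length-applyUpTo g m) ⟩
  sum (zipWith _*_ (upTo m) (applyUpTo g m))                          ≡⟨ sum-zipWith m id ⟩
  ∑[ i < m ] (i * g i)                                                ∎
  where
  open ≡-Reasoning
  sum-zipWith : ∀ m (f : ℕ → ℕ) {g} → sum (zipWith _*_ (applyUpTo f m) (applyUpTo g m)) ≡ ∑[ i < m ] (f i * g i)
  sum-zipWith zero f = refl
  sum-zipWith (suc m) f {g} = cong (f 0 * g 0 +_) (sum-zipWith m (f ∘ suc))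

weight-pr : ∀ {w} → Dyck w → weight (pr w) ≡ sum (map pred (upStrips 0 w))
weight-pr {w} d = begin
  weight (pr w)                                                  ≡⟨ cong weight (pr-upStrips d) ⟩
  weight (applyUpTo (λ i → count (suc i) U) (height w))          ≡⟨ weight-applyUpTo (height w) _ ⟩
  ∑[ i < height w ] (i * count (suc i) U)                        ≡⟨ sym (sum-map-count (suc (height w)) pred (All.map s≤s (upStrips-bounded 0 w))) ⟩
  sum (map pred U)                                               ∎
  where
  open ≡-Reasoning
  U = upStrips 0 w

count-↭ : ∀ {xs ys} → xs ↭ ys → ∀ i → count i xs ≡ count i ys
count-↭ xs↭ys i = ↭-length (filter-↭ (_≟ i) xs↭ys)

maxList-↭ : ∀ {xs ys} → xs ↭ ys → maxList xs ≡ maxList ys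
maxList-↭ xs↭ys = foldr-commMonoid (setoid ℕ) ⊔-0-isCommutativeMonoid (↭⇒↭ₛ xs↭ys)

count-∷-self : ∀ x xs → count x (x ∷ xs) ≡ suc (count x xs)
count-∷-self x xs = trans (count-∷ x x xs) (cong (_+ count x xs) (𝟙-yes (x ≟ x) refl))

count-++ : ∀ i xs ys → count i (xs ++ ys) ≡ count i xs + count i ys
count-++ i xs ys = trans (cong length (filter-++ (_≟ i) xs ys)) (length-++ (filter (_≟ i) xs))

count-map-suc : ∀ i xs → count (suc i) (map suc xs) ≡ count i xs
count-map-suc i [] = refl
count-map-suc i (x ∷ xs) = trans (count-∷ (suc i) (suc x) (map suc xs)) (trans (cong (𝟙 (x ≟ i) +_) (count-map-suc i xs)) (sym (count-∷ i x xs)))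

count-replicate : ∀ m x → count x (replicate m x) ≡ m
count-replicate m x = trans (cong length (filter-all (_≟ x) (replicate⁺ m refl))) (length-replicate m)

count>0⇒∈ : ∀ x ys → 0 < count x ys → x ∈ ys
count>0⇒∈ x (y ∷ ys) count>0 with y ≟ x
... | yes refl = here refl
... | no y≢x = there (count>0⇒∈ x ys (subst (0 <_) (trans (count-∷ x y ys) (cong (_+ count x ys) (𝟙-no (y ≟ x) y≢x))) count>0))

count⇒↭ : ∀ xs ys → (∀ i → count i xs ≡ count i ys) → xs ↭ ys
count⇒↭ [] [] _ = ↭-refl
count⇒↭ [] (y ∷ ys) same = contradiction (trans (same y) (count-∷-self y ys)) 0≢1+n
count⇒↭ (x ∷ xs) ys same with ∈-∃++ (count>0⇒∈ x ys (subst (0 <_) (trans (sym (count-∷-self x xs)) (same x)) (s≤s z≤n)))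
... | ys₁ , ys₂ , refl = ↭-trans (prep x (count⇒↭ xs (ys₁ ++ ys₂) same′)) (↭-sym (shift x ys₁ ys₂))
  where
  same′ : ∀ i → count i xs ≡ count i (ys₁ ++ ys₂)
  same′ i = +-cancelˡ-≡ (𝟙 (x ≟ i)) _ _ (begin
    𝟙 (x ≟ i) + count i xs              ≡⟨ sym (count-∷ i x xs) ⟩
    count i (x ∷ xs)                    ≡⟨ same i ⟩
    count i (ys₁ ++ x ∷ ys₂)            ≡⟨ count-↭ (shift x ys₁ ys₂) i ⟩
    count i (x ∷ ys₁ ++ ys₂)            ≡⟨ count-∷ i x (ys₁ ++ ys₂) ⟩
    𝟙 (x ≟ i) + count i (ys₁ ++ ys₂)    ∎)
    where open ≡-Reasoning

length-pr : ∀ w → length (pr w) ≡ height w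
length-pr w = trans (length-map _ (map suc (upTo (height w)))) (trans (length-map suc (upTo (height w))) (length-upTo (height w)))

module _ {w w′ : Word} (d : Dyck w) (d′ : Dyck w′) where
  private
    U = upStrips 0 w
    U′ = upStrips 0 w′

  count-als : (∀ i → count i U ≡ count i U′) → ∀ h → count h (als w) ≡ count h (als w′)
  count-als same h = begin
    count h (als w)                                    ≡⟨ heights-count d h ⟩
    count h U + count (suc h) U + 𝟙 (h <? 1)           ≡⟨ cong₂ (λ a b → a + b + 𝟙 (h <? 1)) (same h) (same (suc h)) ⟩
    count h U′ + count (suc h) U′ + 𝟙 (h <? 1)         ≡⟨ sym (heights-count d′ h) ⟩
    count h (als w′)                                   ∎
    where open ≡-Reasoning

  count-upStrips : (∀ h → count h (als w) ≡ count h (als w′)) → ∀ i → count i U ≡ count i U′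
  count-upStrips same zero = trans (count-0-upStrips 0 w) (sym (count-0-upStrips 0 w′))
  count-upStrips same (suc i) = +-cancelʳ-≡ (𝟙 (i <? 1)) _ _ (+-cancelˡ-≡ (count i U) _ _ (begin
    count i U + (count (suc i) U + 𝟙 (i <? 1))      ≡⟨ sym (+-assoc (count i U) _ _) ⟩
    count i U + count (suc i) U + 𝟙 (i <? 1)        ≡⟨ sym (heights-count d i) ⟩
    count i (als w)                                 ≡⟨ same i ⟩
    count i (als w′)                                ≡⟨ heights-count d′ i ⟩
    count i U′ + count (suc i) U′ + 𝟙 (i <? 1)      ≡⟨ cong (λ c → c + count (suc i) U′ + 𝟙 (i <? 1)) (sym (count-upStrips same i)) ⟩
    count i U + count (suc i) U′ + 𝟙 (i <? 1)       ≡⟨ +-assoc (count i U) _ _ ⟩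
    count i U + (count (suc i) U′ + 𝟙 (i <? 1))     ∎))
    where open ≡-Reasoning

  pr-from-count : (∀ i → count i U ≡ count i U′) → pr w ≡ pr w′
  pr-from-count same = begin
    pr w                                                ≡⟨ pr-upStrips d ⟩
    applyUpTo (λ i → count (suc i) U) (height w)        ≡⟨ cong (applyUpTo _) height≡ ⟩
    applyUpTo (λ i → count (suc i) U) (height w′)       ≡⟨ applyUpTo-cong (height w′) (λ {i} _ → same (suc i)) ⟩
    applyUpTo (λ i → count (suc i) U′) (height w′)      ≡⟨ sym (pr-upStrips d′) ⟩
    pr w′                                               ∎
    where
    open ≡-Reasoning
    height≡ : height w ≡ height w′
    height≡ = maxList-↭ (count⇒↭ (als w) (als w′) (count-als same))

  height-from-pr : pr w ≡ pr w′ → height w ≡ height w′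
  height-from-pr same = trans (sym (length-pr w)) (trans (cong length same) (length-pr w′))

  count-from-pr : pr w ≡ pr w′ → ∀ i → count i U ≡ count i U′
  count-from-pr _ zero = trans (count-0-upStrips 0 w) (sym (count-0-upStrips 0 w′))
  count-from-pr same (suc i) with suc i ≤? height w
  ... | yes i<height = applyUpTo-injective (height w) (begin
    applyUpTo (λ i → count (suc i) U) (height w)       ≡⟨ sym (pr-upStrips d) ⟩
    pr w                                               ≡⟨ same ⟩
    pr w′                                              ≡⟨ pr-upStrips d′ ⟩
    applyUpTo (λ i → count (suc i) U′) (height w′)     ≡⟨ cong (applyUpTo _) (sym (height-from-pr same)) ⟩
    applyUpTo (λ i → count (suc i) U′) (height w)      ∎) i<height
    where open ≡-Reasoning
  ... | no i≮height = trans (count-upStrips-beyond 0 w height<i)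
                            (sym (count-upStrips-beyond 0 w′ (subst (_< suc i) (height-from-pr same) height<i)))
    where
    height<i : height w < suc i
    height<i = ≰⇒> i≮height

  als↭⇔pr≡ : (als w ↭ als w′) ⇔ (pr w ≡ pr w′)
  als↭⇔pr≡ = mk⇔ (λ als↭ → pr-from-count (count-upStrips (count-↭ als↭)))
                 (λ pr≡ → count⇒↭ (als w) (als w′) (count-als (count-from-pr pr≡)))

F-Dyck : ∀ {n} (M : Matching n) → Dyck (F M)
F-Dyck M = subst Dyck (sym (F≡dyckWord M)) (dyckWord-Dyck (partnerℕ-isMatching M))

crs↭⇔pr≡ : ∀ {n} (M N : Matching n) → (crs M ↭ crs N) ⇔ (pr (F M) ≡ pr (F N))
crs↭⇔pr≡ M N = subst₂ (λ c c′ → (c ↭ c′) ⇔ (pr (F M) ≡ pr (F N))) (sym (crs≡als M)) (sym (crs≡als N))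
  (als↭⇔pr≡ (F-Dyck M) (F-Dyck N))

-- The upper bound

crossings-≤-cover : ∀ N f y → ∑[ x < N ] 𝟙 (crosses? f x y) ≤ cover N f y
crossings-≤-cover N f y = ∑-mono-≤ N (λ {x} _ → 𝟙-mono (crosses? f x y) (covers? x (f x) y)
  (λ (x<y , y<fx , _) → <-trans x<y y<fx , x<y , <⇒≤ y<fx))

crossings-at-closer : ∀ N f {y} → ¬ y < f y → ∑[ x < N ] 𝟙 (crosses? f x y) ≡ 0
crossings-at-closer N f {y} y≮fy = ∑-zero N (λ {x} _ → 𝟙-no (crosses? f x y)
  (λ (_ , y<fx , fx<fy) → y≮fy (<-trans y<fx fx<fy)))

crossings≤weight : ∀ {N f} → IsMatching N f → crossings N f ≤ weight (pr (dyckWord N f))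
crossings≤weight {N} {f} isM = begin
  crossings N f                                                 ≡⟨ ∑-swap N N (λ x y → 𝟙 (crosses? f x y)) ⟩
  ∑[ y < N ] ∑[ x < N ] 𝟙 (crosses? f x y)                     ≤⟨ ∑-mono-≤ N (λ {y} _ → column (y <? f y)) ⟩
  ∑[ y < N ] (if does (y <? f y) then cover N f y else 0)       ≡⟨ cover-upStrips isM ⟩
  sum (map pred (upStrips 0 (dyckWord N f)))                    ≡⟨ sym (weight-pr (dyckWord-Dyck isM)) ⟩
  weight (pr (dyckWord N f))                                    ∎
  where
  open ≤-Reasoning
  column : ∀ {y} (opener? : Dec (y < f y)) → ∑[ x < N ] 𝟙 (crosses? f x y) ≤ (if does opener? then cover N f y else 0)
  column {y} (yes _) = crossings-≤-cover N f y
  column (no y≮fy) = ≤-reflexive (crossings-at-closer N f y≮fy)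

cr≤weight : ∀ {n} (M : Matching n) → cr M ≤ weight (pr (F M))
cr≤weight M = subst₂ (λ c w → c ≤ weight (pr w)) (sym (cr≡crossings M)) (sym (F≡dyckWord M))
  (crossings≤weight (partnerℕ-isMatching M))

-- Realising every crossing number

peaks : ℕ → Word
peaks zero = []
peaks (suc m) = true ∷ false ∷ peaks m

lift : ℕ → Word → Word
lift m w = true ∷ (w ++ false ∷ peaks m)

descent : List ℕ → Word
descent [] = []
descent (x ∷ a) = descent a ++ false ∷ peaks (pred x)

-- staircase [a₁, …, aₘ] = Uᵐ D (UD)^(aₘ - 1) … D (UD)^(a₁ - 1)
staircase : List ℕ → Word
staircase a = replicate (length a) true ++ descent a

staircase-∷ : ∀ x a → staircase (x ∷ a) ≡ lift (pred x) (staircase a)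
staircase-∷ x a = cong (true ∷_) (sym (++-assoc (replicate (length a) true) (descent a) (false ∷ peaks (pred x))))

Path-raise : ∀ {h w e} → Path h w e → Path (suc h) w (suc e)
Path-raise [] = []
Path-raise (up p) = up (Path-raise p)
Path-raise (down p) = down (Path-raise p)

Path-++ : ∀ {h xs e ys e′} → Path h xs e → Path e ys e′ → Path h (xs ++ ys) e′
Path-++ [] q = q
Path-++ (up p) q = up (Path-++ p q)
Path-++ (down p) q = down (Path-++ p q)

peaks-Path : ∀ h m → Path h (peaks m) h
peaks-Path h zero = []
peaks-Path h (suc m) = up (down (peaks-Path h m))

lift-Dyck : ∀ {w} m → Dyck w → Dyck (lift m w)
lift-Dyck m d = up (Path-++ (Path-raise d) (down (peaks-Path 0 m)))

staircase-Dyck : ∀ a → Dyck (staircase a)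
staircase-Dyck [] = []
staircase-Dyck (x ∷ a) = subst Dyck (sym (staircase-∷ x a)) (lift-Dyck (pred x) (staircase-Dyck a))

upStrips-++ : ∀ {h xs e} → Path h xs e → ∀ ys → upStrips h (xs ++ ys) ≡ upStrips h xs ++ upStrips e ys
upStrips-++ [] ys = refl
upStrips-++ (up {h} p) ys = cong (suc h ∷_) (upStrips-++ p ys)
upStrips-++ (down p) ys = upStrips-++ p ys

upStrips-raise : ∀ {h w e} → Path h w e → upStrips (suc h) w ≡ map suc (upStrips h w)
upStrips-raise [] = refl
upStrips-raise (up {h} p) = cong (suc (suc h) ∷_) (upStrips-raise p)
upStrips-raise (down p) = upStrips-raise p

upStrips-peaks : ∀ m → upStrips 0 (peaks m) ≡ replicate m 1
upStrips-peaks zero = refl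
upStrips-peaks (suc m) = cong (1 ∷_) (upStrips-peaks m)

maxList-heightsFrom-++ : ∀ {h xs e} → Path h xs e → ∀ ys →
  maxList (heightsFrom h (xs ++ ys)) ≡ maxList (heightsFrom h xs) ⊔ maxList (heightsFrom e ys)
maxList-heightsFrom-++ {h} [] ys =
  sym (trans (cong (_⊔ maxList (heightsFrom h ys)) (⊔-identityʳ h)) (m≤n⇒m⊔n≡n (≤-maxList-heightsFrom h ys)))
maxList-heightsFrom-++ (up {h} {w} {e} p) ys =
  trans (cong (h ⊔_) (maxList-heightsFrom-++ p ys)) (sym (⊔-assoc h (maxList (heightsFrom (suc h) w)) (maxList (heightsFrom e ys))))
maxList-heightsFrom-++ (down {h} {w} {e} p) ys =
  trans (cong (suc h ⊔_) (maxList-heightsFrom-++ p ys)) (sym (⊔-assoc (suc h) (maxList (heightsFrom h w)) (maxList (heightsFrom e ys))))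

maxList-heightsFrom-raise : ∀ {h w e} → Path h w e → maxList (heightsFrom (suc h) w) ≡ suc (maxList (heightsFrom h w))
maxList-heightsFrom-raise {h} [] = cong suc (sym (⊔-identityʳ h))
maxList-heightsFrom-raise (up p) = cong (suc _ ⊔_) (maxList-heightsFrom-raise p)
maxList-heightsFrom-raise (down p) = cong (suc (suc _) ⊔_) (maxList-heightsFrom-raise p)

maxList-heightsFrom-peaks : ∀ m → maxList (heightsFrom 0 (peaks m)) ≤ 1
maxList-heightsFrom-peaks zero = z≤n
maxList-heightsFrom-peaks (suc m) = ⊔-lub ≤-refl (maxList-heightsFrom-peaks m)

module _ {w : Word} (m : ℕ) (d : Dyck w) where

  height-lift : height (lift m w) ≡ suc (height w)
  height-lift = begin
    maxList (heightsFrom 1 (w ++ false ∷ peaks m))                          ≡⟨ maxList-heightsFrom-++ (Path-raise d) (false ∷ peaks m) ⟩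
    maxList (heightsFrom 1 w) ⊔ (1 ⊔ maxList (heightsFrom 0 (peaks m)))     ≡⟨ cong₂ _⊔_ (maxList-heightsFrom-raise d) (m≥n⇒m⊔n≡m (maxList-heightsFrom-peaks m)) ⟩
    suc (height w) ⊔ 1                                                      ≡⟨ cong suc (⊔-identityʳ (height w)) ⟩
    suc (height w)                                                          ∎
    where open ≡-Reasoning

  upStrips-lift : upStrips 0 (lift m w) ≡ 1 ∷ map suc (upStrips 0 w) ++ replicate m 1
  upStrips-lift = cong (1 ∷_) (trans (upStrips-++ (Path-raise d) (false ∷ peaks m))
    (cong₂ _++_ (upStrips-raise d) (upStrips-peaks m)))

  pr-lift : pr (lift m w) ≡ suc m ∷ pr w
  pr-lift = begin
    pr (lift m w)                                                   ≡⟨ pr-upStrips (lift-Dyck m d) ⟩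
    applyUpTo (λ i → count (suc i) UL) (height (lift m w))         ≡⟨ cong (applyUpTo _) height-lift ⟩
    count 1 UL ∷ applyUpTo (λ i → count (suc (suc i)) UL) (height w) ≡⟨ cong₂ _∷_ count-1 (applyUpTo-cong (height w) (λ {i} _ → count-suc i)) ⟩
    suc m ∷ applyUpTo (λ i → count (suc i) U) (height w)            ≡⟨ cong (suc m ∷_) (sym (pr-upStrips d)) ⟩
    suc m ∷ pr w                                                    ∎
    where
    open ≡-Reasoning
    U = upStrips 0 w
    UL = upStrips 0 (lift m w)
    count-1 : count 1 UL ≡ suc m
    count-1 = begin
      count 1 UL                                          ≡⟨ cong (count 1) upStrips-lift ⟩
      suc (count 1 (map suc U ++ replicate m 1))          ≡⟨ cong suc (count-++ 1 (map suc U) (replicate m 1)) ⟩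
      suc (count 1 (map suc U) + count 1 (replicate m 1)) ≡⟨ cong suc (cong₂ _+_ (trans (count-map-suc 0 U) (count-0-upStrips 0 w)) (count-replicate m 1)) ⟩
      suc m                                               ∎
    count-suc : ∀ i → count (suc (suc i)) UL ≡ count (suc i) U
    count-suc i = begin
      count (suc (suc i)) UL                                                  ≡⟨ cong (count (suc (suc i))) upStrips-lift ⟩
      count (suc (suc i)) (map suc U ++ replicate m 1)                        ≡⟨ count-++ (suc (suc i)) (map suc U) (replicate m 1) ⟩
      count (suc (suc i)) (map suc U) + count (suc (suc i)) (replicate m 1)   ≡⟨ cong₂ _+_ (count-map-suc (suc i) U) (count-none (suc (suc i)) (replicate⁺ m (λ ()))) ⟩
      count (suc i) U + 0                                                     ≡⟨ +-identityʳ _ ⟩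
      count (suc i) U                                                         ∎

pr-staircase : ∀ {a} → All (0 <_) a → pr (staircase a) ≡ a
pr-staircase [] = refl
pr-staircase {suc m ∷ a} (_ ∷ pos) = begin
  pr (staircase (suc m ∷ a))      ≡⟨ cong pr (staircase-∷ (suc m) a) ⟩
  pr (lift m (staircase a))       ≡⟨ pr-lift m (staircase-Dyck a) ⟩
  suc m ∷ pr (staircase a)        ≡⟨ cong (suc m ∷_) (pr-staircase pos) ⟩
  suc m ∷ a                       ∎
  where open ≡-Reasoning

Realisable : ℕ → Word → ℕ → Set
Realisable N w i = ∃ λ f → IsMatching N f × dyckWord N f ≡ w × crossings N f ≡ i

Realisable-cast : ∀ {N N′ w w′ i i′} → N ≡ N′ → w ≡ w′ → i ≡ i′ → Realisable N w i → Realisable N′ w′ i′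
Realisable-cast refl refl refl r = r

-- Insert a new arc {a, b}, b = L + 1, into f, whose word starts with L = a + k up-steps; the old
-- positions move along ι. The word becomes Uᴸ U D R, and the new arc crosses exactly the k arcs
-- opened at a, …, L - 1, which all close after b.
module Twist {N : ℕ} {f : ℕ → ℕ} (isM : IsMatching N f) (a k : ℕ) {R : Word}
             (prefix : dyckWord N f ≡ replicate (a + k) true ++ R) where
  open IsMatching isM

  L b : ℕ
  L = a + k
  b = suc L

  L≤N : L ≤ N
  L≤N = proj₁ (applyUpTo-replicate-prefix N L prefix)

  a<b : a < b
  a<b = s≤s (m≤m+n a k)

  b≤1+N : b ≤ suc N
  b≤1+N = s≤s L≤N

  opens-in-prefix : ∀ {j} → j < L → j < f j
  opens-in-prefix {j} j<L = from-does (j <? f j) (proj₂ (applyUpTo-replicate-prefix N L prefix) j<L)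

  closes-after-prefix : ∀ {j} → j < L → L ≤ f j
  closes-after-prefix {j} j<L = ≮⇒≥ (λ fj<L → <-asym (opens-in-prefix j<L)
    (subst (f j <_) (self-inverse (<-≤-trans j<L L≤N)) (opens-in-prefix fj<L)))

  ι : ℕ → ℕ
  ι = punchIn b ∘ punchIn a

  g : ℕ → ℕ
  g x = if does (x ≟ a) then b else if does (x ≟ b) then a else ι (f (punchOut a (punchOut b x)))

  ι-mono-< : ∀ {x y} → x < y → ι x < ι y
  ι-mono-< = punchIn-mono-< b ∘ punchIn-mono-< a

  ι-cancel-< : ∀ {x y} → ι x < ι y → x < y
  ι-cancel-< = punchIn-cancel-< a ∘ punchIn-cancel-< b

  ι-injective : ∀ {x y} → ι x ≡ ι y → x ≡ y
  ι-injective = punchIn-injective a ∘ punchIn-injective b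

  ι-bounded : ∀ {j} → j < N → ι j < suc (suc N)
  ι-bounded = punchIn-bounded b ∘ punchIn-bounded a

  ι-inflationary : ∀ j → j ≤ ι j
  ι-inflationary j = ≤-trans (punchIn-inflationary a j) (punchIn-inflationary b _)

  ι-below : ∀ {j} → j < a → ι j ≡ j
  ι-below j<a = trans (cong (punchIn b) (punchIn-< j<a)) (punchIn-< (<-trans j<a a<b))

  ι-middle : ∀ {j} → a ≤ j → j < L → ι j ≡ suc j
  ι-middle a≤j j<L = trans (cong (punchIn b) (punchIn-≥ a≤j)) (punchIn-< (s≤s j<L))

  ι-above : ∀ {j} → L ≤ j → ι j ≡ suc (suc j)
  ι-above L≤j = trans (cong (punchIn b) (punchIn-≥ (≤-trans (m≤m+n a k) L≤j))) (punchIn-≥ (s≤s L≤j))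

  ι≢b : ∀ j → ι j ≢ b
  ι≢b j = punchInᵢ≢i b (punchIn a j)

  ι≢a : ∀ j → ι j ≢ a
  ι≢a j ιj≡a with punchIn a j <? b
  ... | yes y<b = punchInᵢ≢i a j (trans (sym (punchIn-< y<b)) ιj≡a)
  ... | no y≮b = <-irrefl (sym ιj≡a) (<-≤-trans a<b (≤-trans (≮⇒≥ y≮b) (≤-trans (n≤1+n _) (≤-reflexive (sym (punchIn-≥ (≮⇒≥ y≮b)))))))

  ι-cases : ∀ {x} → x < suc (suc N) → x ≡ a ⊎ x ≡ b ⊎ ∃ λ j → j < N × ι j ≡ x
  ι-cases {x} x<2+N with x ≟ a | x ≟ b
  ... | yes x≡a | _ = inj₁ x≡a
  ... | no _ | yes x≡b = inj₂ (inj₁ x≡b)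
  ... | no x≢a | no x≢b with punchIn-surjective b≤1+N x<2+N x≢b
  ...   | y , y<1+N , by≡x with punchIn-surjective (m<1+n⇒m≤n (<-≤-trans a<b b≤1+N)) y<1+N y≢a
    where
    y≢a : y ≢ a
    y≢a y≡a = x≢a (trans (sym by≡x) (trans (cong (punchIn b) y≡a) (punchIn-< a<b)))
  ...     | j , j<N , aj≡y = inj₂ (inj₂ (j , j<N , trans (cong (punchIn b) aj≡y) by≡x))

  g-a : g a ≡ b
  g-a rewrite dec-true (a ≟ a) refl = refl

  g-b : g b ≡ a
  g-b rewrite dec-false (b ≟ a) (>⇒≢ a<b) | dec-true (b ≟ b) refl = refl

  g-ι : ∀ j → g (ι j) ≡ ι (f j)
  g-ι j rewrite dec-false (ι j ≟ a) (ι≢a j) | dec-false (ι j ≟ b) (ι≢b j)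
              | punchOut-punchIn b (punchIn a j) | punchOut-punchIn a j = refl

  g-isMatching : IsMatching (suc (suc N)) g
  g-isMatching = record { bounded = g-bounded ; self-inverse = g-self-inverse ; no-fixpoint = g-no-fixpoint }
    where
    g-bounded : ∀ {x} → x < suc (suc N) → g x < suc (suc N)
    g-bounded x<2+N with ι-cases x<2+N
    ... | inj₁ refl = subst (_< suc (suc N)) (sym g-a) (s≤s b≤1+N)
    ... | inj₂ (inj₁ refl) = subst (_< suc (suc N)) (sym g-b) (<-trans a<b (s≤s b≤1+N))
    ... | inj₂ (inj₂ (j , j<N , refl)) = subst (_< suc (suc N)) (sym (g-ι j)) (ι-bounded (bounded j<N))
    g-self-inverse : ∀ {x} → x < suc (suc N) → g (g x) ≡ x
    g-self-inverse x<2+N with ι-cases x<2+N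
    ... | inj₁ refl = trans (cong g g-a) g-b
    ... | inj₂ (inj₁ refl) = trans (cong g g-b) g-a
    ... | inj₂ (inj₂ (j , j<N , refl)) = trans (cong g (g-ι j)) (trans (g-ι (f j)) (cong ι (self-inverse j<N)))
    g-no-fixpoint : ∀ {x} → x < suc (suc N) → g x ≢ x
    g-no-fixpoint x<2+N with ι-cases x<2+N
    ... | inj₁ refl = λ ga≡a → >⇒≢ a<b (trans (sym g-a) ga≡a)
    ... | inj₂ (inj₁ refl) = λ gb≡b → <⇒≢ a<b (trans (sym g-b) gb≡b)
    ... | inj₂ (inj₂ (j , j<N , refl)) = λ gιj≡ιj → no-fixpoint j<N (ι-injective (trans (sym (g-ι j)) gιj≡ιj))

  opens-ι : ∀ j → does (ι j <? g (ι j)) ≡ does (j <? f j)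
  opens-ι j = trans (cong (does ∘ (ι j <?_)) (g-ι j)) (does-⇔ (mk⇔ ι-cancel-< ι-mono-<) (ι j <? ι (f j)) (j <? f j))

  g-dyckWord : dyckWord (suc (suc N)) g ≡ replicate L true ++ true ∷ false ∷ R
  g-dyckWord = begin
    applyUpTo u (suc (suc N))                                    ≡⟨ applyUpTo-punchIn₂ N u a<b b≤1+N ⟩
    insertAt (insertAt (applyUpTo (u ∘ ι) N) a (u a)) b (u b)    ≡⟨ cong₂ (λ p q → insertAt (insertAt (applyUpTo (u ∘ ι) N) a p) b q) u-a u-b ⟩
    insertAt (insertAt (applyUpTo (u ∘ ι) N) a true) b false     ≡⟨ cong (λ l → insertAt (insertAt l a true) b false) (trans (applyUpTo-cong N (λ {j} _ → opens-ι j)) prefix) ⟩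
    insertAt (insertAt (replicate L true ++ R) a true) b false   ≡⟨ cong (λ l → insertAt l b false) (insertAt-replicate true R (m≤m+n a k)) ⟩
    true ∷ insertAt (replicate L true ++ R) L false              ≡⟨ cong (true ∷_) (insertAt-after-replicate L true false R) ⟩
    true ∷ replicate L true ++ false ∷ R                         ≡⟨ ∷-replicate-++ L true (false ∷ R) ⟩
    replicate L true ++ true ∷ false ∷ R                         ∎
    where
    open ≡-Reasoning
    u : ℕ → Bool
    u x = does (x <? g x)
    u-a : u a ≡ true
    u-a = trans (cong (does ∘ (a <?_)) g-a) (dec-true (a <? b) a<b)
    u-b : u b ≡ false
    u-b = trans (cong (does ∘ (b <?_)) g-b) (dec-false (b <? a) (<-asym a<b))

  ι<b⇒<L : ∀ {j} → ι j < b → j < L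
  ι<b⇒<L ιj<b = ≰⇒> (λ L≤j → <-asym ιj<b (subst (b <_) (sym (ι-above L≤j)) (s≤s (s≤s L≤j))))

  a<ι⇒a≤ : ∀ {j} → a < ι j → a ≤ j
  a<ι⇒a≤ a<ιj = ≮⇒≥ (λ j<a → <-asym j<a (subst (a <_) (ι-below j<a) a<ιj))

  crosses-ι : ∀ x y → 𝟙 (crosses? g (ι x) (ι y)) ≡ 𝟙 (crosses? f x y)
  crosses-ι x y = 𝟙-cong (crosses? g (ι x) (ι y)) (crosses? f x y)
    (λ (ιx<ιy , ιy<gιx , gιx<gιy) →
      ι-cancel-< ιx<ιy , ι-cancel-< (subst (ι y <_) (g-ι x) ιy<gιx) , ι-cancel-< (subst₂ _<_ (g-ι x) (g-ι y) gιx<gιy))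
    (λ (x<y , y<fx , fx<fy) →
      ι-mono-< x<y , subst (ι y <_) (sym (g-ι x)) (ι-mono-< y<fx) , subst₂ _<_ (sym (g-ι x)) (sym (g-ι y)) (ι-mono-< fx<fy))

  row : ℕ → ℕ
  row x = ∑[ y < suc (suc N) ] 𝟙 (crosses? g x y)

  row-b : row b ≡ 0
  row-b = ∑-zero (suc (suc N)) (λ {y} _ → 𝟙-no (crosses? g b y)
    (λ (b<y , y<gb , _) → <-asym a<b (<-trans b<y (subst (y <_) g-b y<gb))))

  row-a : row a ≡ k
  row-a = begin
    row a                                                                           ≡⟨ ∑-punchIn₂ N (λ y → 𝟙 (crosses? g a y)) a<b b≤1+N ⟩
    𝟙 (crosses? g a b) + (𝟙 (crosses? g a a) + ∑[ j < N ] 𝟙 (crosses? g a (ι j)))  ≡⟨ cong₂ (λ p q → p + (q + ∑[ j < N ] 𝟙 (crosses? g a (ι j)))) ab aa ⟩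
    ∑[ j < N ] 𝟙 (crosses? g a (ι j))                                               ≡⟨ ∑-cong N (λ {j} _ → 𝟙-cong (crosses? g a (ι j)) (a ≤? j ×-dec j <? L) crossed⇒inside inside⇒crossed) ⟩
    ∑[ j < N ] 𝟙 (a ≤? j ×-dec j <? a + k)                                         ≡⟨ ∑-interval N a k L≤N ⟩
    k                                                                               ∎
    where
    open ≡-Reasoning
    ab : 𝟙 (crosses? g a b) ≡ 0
    ab = 𝟙-no (crosses? g a b) (λ (_ , b<ga , _) → <-irrefl (sym g-a) b<ga)
    aa : 𝟙 (crosses? g a a) ≡ 0
    aa = 𝟙-no (crosses? g a a) (λ (a<a , _) → <-irrefl refl a<a)
    crossed⇒inside : ∀ {j} → Crosses g a (ι j) → a ≤ j × j < L
    crossed⇒inside (a<ιj , ιj<ga , _) = a<ι⇒a≤ a<ιj , ι<b⇒<L (subst (_ <_) g-a ιj<ga)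
    inside⇒crossed : ∀ {j} → a ≤ j × j < L → Crosses g a (ι j)
    inside⇒crossed {j} (a≤j , j<L) =
        subst (a <_) (sym (ι-middle a≤j j<L)) (s≤s a≤j)
      , subst₂ _<_ (sym (ι-middle a≤j j<L)) (sym g-a) (s≤s j<L)
      , subst₂ _<_ (sym g-a) (sym (trans (g-ι j) (ι-above (closes-after-prefix j<L)))) (s≤s (s≤s (closes-after-prefix j<L)))

  row-ι : ∀ {j} → j < N → row (ι j) ≡ ∑[ y < N ] 𝟙 (crosses? f j y)
  row-ι {j} j<N = begin
    row (ι j)                                                   ≡⟨ ∑-punchIn₂ N (λ y → 𝟙 (crosses? g (ι j) y)) a<b b≤1+N ⟩
    𝟙 (crosses? g (ι j) b) + (𝟙 (crosses? g (ι j) a) + rest)    ≡⟨ cong₂ (λ p q → p + (q + rest)) (𝟙-no (crosses? g (ι j) b) not-b) (𝟙-no (crosses? g (ι j) a) not-a) ⟩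
    rest                                                        ≡⟨ ∑-cong N (λ {y} _ → crosses-ι j y) ⟩
    ∑[ y < N ] 𝟙 (crosses? f j y)                               ∎
    where
    open ≡-Reasoning
    rest = ∑[ y < N ] 𝟙 (crosses? g (ι j) (ι y))
    not-b : ¬ Crosses g (ι j) b
    not-b (_ , b<gιj , gιj<gb) = <-asym a<b (<-trans b<gιj (subst (g (ι j) <_) g-b gιj<gb))
    not-a : ¬ Crosses g (ι j) a
    not-a (ιj<a , a<gιj , gιj<ga) = <-asym fj<j (<-≤-trans (≤-<-trans (ι-inflationary j) ιj<a) (a<ι⇒a≤ (subst (a <_) (g-ι j) a<gιj)))
      where
      fj<j : f j < j
      fj<j = subst (f j <_) (self-inverse j<N) (opens-in-prefix (ι<b⇒<L (subst₂ _<_ (g-ι j) g-a gιj<ga)))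

  g-crossings : crossings (suc (suc N)) g ≡ k + crossings N f
  g-crossings = begin
    crossings (suc (suc N)) g                    ≡⟨ ∑-punchIn₂ N row a<b b≤1+N ⟩
    row b + (row a + ∑[ j < N ] row (ι j))       ≡⟨ cong₂ (λ p q → p + (q + ∑[ j < N ] row (ι j))) row-b row-a ⟩
    k + ∑[ j < N ] row (ι j)                     ≡⟨ cong (k +_) (∑-cong N row-ι) ⟩
    k + crossings N f                            ∎
    where open ≡-Reasoning

  twisted : Realisable (suc (suc N)) (replicate L true ++ true ∷ false ∷ R) (k + crossings N f)
  twisted = g , g-isMatching , g-dyckWord , g-crossings

twist : ∀ {N L R i} a k → a + k ≡ L → Realisable N (replicate L true ++ R) i →
  Realisable (suc (suc N)) (replicate L true ++ true ∷ false ∷ R) (k + i)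
twist a k refl (f , isM , prefix , refl) = Twist.twisted isM a k prefix

add-peaks : ∀ x L {N R i t} → t ≤ x * L → Realisable N (replicate L true ++ R) i →
  Realisable (2 * x + N) (replicate L true ++ peaks x ++ R) (t + i)
add-peaks zero L {t = zero} _ r = r
add-peaks (suc x) L {N} {R} {i} {t} t≤ r with ≤-+-split L (x * L) t≤
... | k , t′ , k≤L , t′≤ , refl = Realisable-cast (sym size) refl (sym (+-assoc k t′ i))
  (twist (L ∸ k) k (m∸n+n≡m k≤L) (add-peaks x L t′≤ r))
  where
  size : 2 * suc x + N ≡ suc (suc (2 * x + N))
  size = cong (λ m → suc m + N) (+-suc x (x + 0))

weight-∷ʳ : ∀ a x → weight (a ∷ʳ x) ≡ weight a + length a * x
weight-∷ʳ a x = begin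
  sum (zipWith _*_ (upTo (length (a ∷ʳ x))) (a ∷ʳ x))        ≡⟨ cong (λ l → sum (zipWith _*_ (upTo l) (a ∷ʳ x))) (length-∷ʳ a x) ⟩
  sum (zipWith _*_ (upTo (suc (length a))) (a ∷ʳ x))          ≡⟨ cong (λ l → sum (zipWith _*_ l (a ∷ʳ x))) (sym (upTo-∷ʳ (length a))) ⟩
  sum (zipWith _*_ (upTo (length a) ∷ʳ length a) (a ∷ʳ x))    ≡⟨ cong sum (zipWith-∷ʳ _*_ {upTo (length a)} {a} (length a) x (length-upTo (length a))) ⟩
  sum (zipWith _*_ (upTo (length a)) a ∷ʳ length a * x)       ≡⟨ sum-++ (zipWith _*_ (upTo (length a)) a) _ ⟩
  weight a + (length a * x + 0)                               ≡⟨ cong (weight a +_) (+-identityʳ _) ⟩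
  weight a + length a * x                                     ∎
  where open ≡-Reasoning

descent-∷ʳ : ∀ a x → descent (a ∷ʳ x) ≡ false ∷ peaks (pred x) ++ descent a
descent-∷ʳ [] x = cong (false ∷_) (sym (++-identityʳ (peaks (pred x))))
descent-∷ʳ (y ∷ a) x = trans (cong (_++ false ∷ peaks (pred y)) (descent-∷ʳ a x))
  (cong (false ∷_) (++-assoc (peaks (pred x)) (descent a) (false ∷ peaks (pred y))))

staircase-∷ʳ : ∀ a m → staircase (a ∷ʳ suc m) ≡ replicate (length a) true ++ peaks (suc m) ++ descent a
staircase-∷ʳ a m = trans (cong₂ (λ l d → replicate l true ++ d) (length-∷ʳ a (suc m)) (descent-∷ʳ a (suc m)))
  (∷-replicate-++ (length a) true (false ∷ peaks m ++ descent a))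

realise-staircase : ∀ {a} → Reverse a → All (0 <_) a → ∀ {i} → i ≤ weight a → Realisable (2 * sum a) (staircase a) i
realise-staircase [] _ z≤n = id , record { bounded = λ () ; self-inverse = λ () ; no-fixpoint = λ () } , refl , refl
realise-staircase (a ∶ ra ∶ʳ x) pos {i} i≤ with ++⁻ʳ a pos | ≤-+-split (weight a) (length a * x) (subst (i ≤_) (weight-∷ʳ a x) i≤)
... | s≤s z≤n ∷ [] | p , q , p≤ , q≤ , refl =
  Realisable-cast size (sym (staircase-∷ʳ a _)) (+-comm q p)
    (add-peaks x (length a) (subst (q ≤_) (*-comm (length a) x) q≤) (realise-staircase ra (++⁻ˡ a pos) p≤))
  where
  size : 2 * x + 2 * sum a ≡ 2 * sum (a ∷ʳ x)
  size = trans (rearrange x (sum a)) (cong (2 *_) (sym (sum-++ a (x ∷ []))))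
    where
    rearrange : ∀ x s → 2 * x + 2 * s ≡ 2 * (s + (x + 0))
    rearrange = solve-∀

realise : ∀ n (a : List ℕ) → IsComposition n a → (i : ℕ) → i ≤ weight a →
  Σ (Matching n) (λ M → pr (F M) ≡ a × cr M ≡ i)
realise _ a (pos , refl) i i≤ with realise-staircase (reverseView a) pos i≤
... | f , isM , word≡ , crossings≡ =
    toMatching {sum a} isM
  , trans (cong pr (trans (F-toMatching {sum a} isM) word≡)) (pr-staircase pos)
  , trans (cr-toMatching {sum a} isM) crossings≡

lemma3p2 : (n : ℕ) →
    ((M : Matching n) → crs M ≡ als (F M))
    × ((M N : Matching n) → (crs M ↭ crs N) ⇔ (pr (F M) ≡ pr (F N)))
    × ((a : List ℕ) → IsComposition n a → (i : ℕ) → i ≤ weight a →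
        Σ (Matching n) (λ M → pr (F M) ≡ a × cr M ≡ i))
    × ¬ (Σ (List ℕ) (λ a → Σ (Matching n) (λ M →
        IsComposition n a × pr (F M) ≡ a × weight a < cr M)))
lemma3p2 n = crs≡als , crs↭⇔pr≡ , realise n ,
  λ (_ , M , _ , pr≡a , weight<cr) → <⇒≱ weight<cr (subst (λ a → cr M ≤ weight a) pr≡a (cr≤weight M))
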